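{- Let $\mathsf{C}$ be a symmetric monoidal category with finite products. Let $!_1$ be a comonad on $\mathsf{C}$ preserving finite products, $!_2$ a storage comonad on $\mathsf{C}$, and $\lambda$ a distributive law of $!_1$ over $!_2$. Then the composite comonad $!_{12}=!_2\circ!_1$ is a storage comonad on $\mathsf{C}$.
   Context: A storage comonad on a symmetric monoidal category $(\mathsf{C},\otimes,1)$ with finite products $(\times,*)$ is a comonad $(!,\mu,\epsilon)$ such that (1) each $!A$ is a cocommutative comonoid $(!A,c_A,e_A)$ with $c,e$ natural; (2) each $\mu_A:!A\to!!A$ is a comonoid morphism; (3) $!(*)\to1$ and $(!(\pi_1)\otimes!(\pi_2))\circ c_{A\times B}:!(A\times B)\to!A\otimes!B$ are isomorphisms. For comonads $(!_1,\mu^1,\epsilon^1)$, $(!_2,\mu^2,\epsilon^2)$, a distributive law of $!_1$ over $!_2$ is a natural transformation $\lambda:!_2\circ!_1\to!_1\circ!_2$ compatible with the comultiplications and counits (the standard Beck axioms: $(!_1\lambda)(\lambda!_1)(!_2\mu^1)=(\mu^1!_2)\lambda$, $(\lambda!_2)(!_2\lambda)(\mu^2!_1)=(!_1\mu^2)\lambda$, $(!_1\epsilon^2)\lambda=\epsilon^2!_1$, $(\epsilon^1!_2)\lambda=!_2\epsilon^1$). The composite comonad $!_{12}=!_2\circ!_1$ has comultiplication $(!_2\lambda!_1)\circ(\mu^2\circ\mu^1)$ and counit $\epsilon^2\circ\epsilon^1$. -}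

module Defs where

open import Level using (Level; _⊔_) renaming (suc to lsuc)
open import Relation.Binary using (Rel; IsEquivalence)
open import Data.Product using (Σ; _×_; _,_)

record Category (o ℓ e : Level) : Set (lsuc (o ⊔ ℓ ⊔ e)) where
  infixr 9 _∘_
  infix  4 _≈_ _⇒_
  field
    Obj       : Set o
    _⇒_       : Obj → Obj → Set ℓ
    _≈_       : ∀ {A B} → Rel (A ⇒ B) e
    id        : ∀ {A} → A ⇒ A
    _∘_       : ∀ {A B C} → B ⇒ C → A ⇒ B → A ⇒ C
    equiv     : ∀ {A B} → IsEquivalence (_≈_ {A} {B})
    ∘-resp-≈  : ∀ {A B C} {f f′ : B ⇒ C} {g g′ : A ⇒ B} →
                f ≈ f′ → g ≈ g′ → f ∘ g ≈ f′ ∘ g′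
    assoc     : ∀ {A B C D} {f : A ⇒ B} {g : B ⇒ C} {h : C ⇒ D} →
                (h ∘ g) ∘ f ≈ h ∘ (g ∘ f)
    identityˡ : ∀ {A B} {f : A ⇒ B} → id ∘ f ≈ f
    identityʳ : ∀ {A B} {f : A ⇒ B} → f ∘ id ≈ f

module _ {o ℓ ℓₑ : Level} (C : Category o ℓ ℓₑ) where
  open Category C

  IsIso : ∀ {A B} → A ⇒ B → Set (ℓ ⊔ ℓₑ)
  IsIso {A} {B} f = Σ (B ⇒ A) λ g → (g ∘ f ≈ id) × (f ∘ g ≈ id)

  record SymmetricMonoidal : Set (o ⊔ ℓ ⊔ ℓₑ) where
    infixr 10 _⊗₀_ _⊗₁_
    field
      _⊗₀_        : Obj → Obj → Obj
      _⊗₁_        : ∀ {A B C D} → A ⇒ B → C ⇒ D → (A ⊗₀ C) ⇒ (B ⊗₀ D)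
      ⊗-identity  : ∀ {A B} → id {A} ⊗₁ id {B} ≈ id
      ⊗-homomorphism : ∀ {A B C D E F} {f : B ⇒ C} {g : A ⇒ B} {h : E ⇒ F} {k : D ⇒ E} →
                    (f ∘ g) ⊗₁ (h ∘ k) ≈ (f ⊗₁ h) ∘ (g ⊗₁ k)
      ⊗-resp-≈    : ∀ {A B C D} {f f′ : A ⇒ B} {g g′ : C ⇒ D} →
                    f ≈ f′ → g ≈ g′ → f ⊗₁ g ≈ f′ ⊗₁ g′
      unit        : Obj
      α⇒          : ∀ {A B C} → (A ⊗₀ B) ⊗₀ C ⇒ A ⊗₀ (B ⊗₀ C)
      α⇐          : ∀ {A B C} → A ⊗₀ (B ⊗₀ C) ⇒ (A ⊗₀ B) ⊗₀ C
      λ⇒          : ∀ {A} → unit ⊗₀ A ⇒ A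
      λ⇐          : ∀ {A} → A ⇒ unit ⊗₀ A
      ρ⇒          : ∀ {A} → A ⊗₀ unit ⇒ A
      ρ⇐          : ∀ {A} → A ⇒ A ⊗₀ unit
      σ           : ∀ {A B} → A ⊗₀ B ⇒ B ⊗₀ A
      α-isoˡ      : ∀ {A B C} → α⇐ {A} {B} {C} ∘ α⇒ ≈ id
      α-isoʳ      : ∀ {A B C} → α⇒ {A} {B} {C} ∘ α⇐ ≈ id
      λ-isoˡ      : ∀ {A} → λ⇐ {A} ∘ λ⇒ ≈ id
      λ-isoʳ      : ∀ {A} → λ⇒ {A} ∘ λ⇐ ≈ id
      ρ-isoˡ      : ∀ {A} → ρ⇐ {A} ∘ ρ⇒ ≈ id
      ρ-isoʳ      : ∀ {A} → ρ⇒ {A} ∘ ρ⇐ ≈ id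
      α-natural   : ∀ {A B C D E F} {f : A ⇒ D} {g : B ⇒ E} {h : C ⇒ F} →
                    α⇒ ∘ ((f ⊗₁ g) ⊗₁ h) ≈ (f ⊗₁ (g ⊗₁ h)) ∘ α⇒
      λ-natural   : ∀ {A B} {f : A ⇒ B} → λ⇒ ∘ (id ⊗₁ f) ≈ f ∘ λ⇒
      ρ-natural   : ∀ {A B} {f : A ⇒ B} → ρ⇒ ∘ (f ⊗₁ id) ≈ f ∘ ρ⇒
      σ-natural   : ∀ {A B C D} {f : A ⇒ B} {g : C ⇒ D} →
                    σ ∘ (f ⊗₁ g) ≈ (g ⊗₁ f) ∘ σ
      pentagon    : ∀ {A B C D} →
                    (id {A} ⊗₁ α⇒ {B} {C} {D}) ∘ α⇒ ∘ (α⇒ ⊗₁ id) ≈ α⇒ ∘ α⇒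
      triangle    : ∀ {A B} → (id {A} ⊗₁ λ⇒ {B}) ∘ α⇒ ≈ ρ⇒ ⊗₁ id
      σ-involutive : ∀ {A B} → σ {B} {A} ∘ σ {A} {B} ≈ id
      hexagon     : ∀ {A B C} →
                    α⇒ {B} {C} {A} ∘ σ {A} {B ⊗₀ C} ∘ α⇒ ≈
                    (id ⊗₁ σ) ∘ α⇒ ∘ (σ ⊗₁ id)

  record FiniteProducts : Set (o ⊔ ℓ ⊔ ℓₑ) where
    infixr 11 _×₀_
    field
      ⊤        : Obj
      !        : ∀ {A} → A ⇒ ⊤
      !-unique : ∀ {A} (f : A ⇒ ⊤) → ! ≈ f
      _×₀_     : Obj → Obj → Obj
      π₁       : ∀ {A B} → A ×₀ B ⇒ A
      π₂       : ∀ {A B} → A ×₀ B ⇒ B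
      ⟨_,_⟩    : ∀ {A B X} → X ⇒ A → X ⇒ B → X ⇒ A ×₀ B
      project₁ : ∀ {A B X} {f : X ⇒ A} {g : X ⇒ B} → π₁ ∘ ⟨ f , g ⟩ ≈ f
      project₂ : ∀ {A B X} {f : X ⇒ A} {g : X ⇒ B} → π₂ ∘ ⟨ f , g ⟩ ≈ g
      ⟨⟩-unique : ∀ {A B X} {f : X ⇒ A} {g : X ⇒ B} {h : X ⇒ A ×₀ B} →
                  π₁ ∘ h ≈ f → π₂ ∘ h ≈ g → ⟨ f , g ⟩ ≈ h

  record Endofunctor : Set (o ⊔ ℓ ⊔ ℓₑ) where
    field
      F₀           : Obj → Obj
      F₁           : ∀ {A B} → A ⇒ B → F₀ A ⇒ F₀ B
      identity     : ∀ {A} → F₁ (id {A}) ≈ id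
      homomorphism : ∀ {A B C} {f : A ⇒ B} {g : B ⇒ C} → F₁ (g ∘ f) ≈ F₁ g ∘ F₁ f
      F-resp-≈     : ∀ {A B} {f g : A ⇒ B} → f ≈ g → F₁ f ≈ F₁ g

  record RawComonad : Set (o ⊔ ℓ ⊔ ℓₑ) where
    field
      functor : Endofunctor
    open Endofunctor functor public
    field
      ε : ∀ A → F₀ A ⇒ A
      δ : ∀ A → F₀ A ⇒ F₀ (F₀ A)

  record IsComonad (K : RawComonad) : Set (o ⊔ ℓ ⊔ ℓₑ) where
    open RawComonad K
    field
      ε-natural : ∀ {A B} {f : A ⇒ B} → ε B ∘ F₁ f ≈ f ∘ ε A
      δ-natural : ∀ {A B} {f : A ⇒ B} → δ B ∘ F₁ f ≈ F₁ (F₁ f) ∘ δ A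
      identityˡ-ε : ∀ {A} → F₁ (ε A) ∘ δ A ≈ id
      identityʳ-ε : ∀ {A} → ε (F₀ A) ∘ δ A ≈ id
      δ-assoc     : ∀ {A} → F₁ (δ A) ∘ δ A ≈ δ (F₀ A) ∘ δ A

  record Comonad : Set (o ⊔ ℓ ⊔ ℓₑ) where
    field
      raw       : RawComonad
      isComonad : IsComonad raw
    open RawComonad raw public
    open IsComonad isComonad public

  PreservesFiniteProducts : FiniteProducts → Comonad → Set (o ⊔ ℓ ⊔ ℓₑ)
  PreservesFiniteProducts P K =
      IsIso (! {F₀ ⊤})
    × (∀ A B → IsIso (⟨ F₁ (π₁ {A} {B}) , F₁ (π₂ {A} {B}) ⟩))
    where open FiniteProducts P
          open Comonad K

  module _ (M : SymmetricMonoidal) (P : FiniteProducts) where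
    open SymmetricMonoidal M
    open FiniteProducts P

    record IsCocommutativeComonoid (X : Obj) (c : X ⇒ X ⊗₀ X) (e : X ⇒ unit)
           : Set ℓₑ where
      field
        counitˡ : λ⇒ ∘ (e ⊗₁ id) ∘ c ≈ id
        counitʳ : ρ⇒ ∘ (id ⊗₁ e) ∘ c ≈ id
        coassoc : α⇒ ∘ (c ⊗₁ id) ∘ c ≈ (id ⊗₁ c) ∘ c
        cocomm  : σ ∘ c ≈ c

    record StorageStructure (K : RawComonad) : Set (o ⊔ ℓ ⊔ ℓₑ) where
      open RawComonad K
      field
        c : ∀ A → F₀ A ⇒ F₀ A ⊗₀ F₀ A
        e : ∀ A → F₀ A ⇒ unit
        comonoid  : ∀ A → IsCocommutativeComonoid (F₀ A) (c A) (e A)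
        c-natural : ∀ {A B} {f : A ⇒ B} → c B ∘ F₁ f ≈ (F₁ f ⊗₁ F₁ f) ∘ c A
        e-natural : ∀ {A B} {f : A ⇒ B} → e B ∘ F₁ f ≈ e A
        δ-c : ∀ A → c (F₀ A) ∘ δ A ≈ (δ A ⊗₁ δ A) ∘ c A
        δ-e : ∀ A → e (F₀ A) ∘ δ A ≈ e A
        seely-unit : IsIso (e ⊤)
        seely-pair : ∀ A B → IsIso ((F₁ (π₁ {A} {B}) ⊗₁ F₁ (π₂ {A} {B})) ∘ c (A ×₀ B))

    IsStorageComonad : RawComonad → Set (o ⊔ ℓ ⊔ ℓₑ)
    IsStorageComonad K = IsComonad K × StorageStructure K

    StorageComonad : Set (o ⊔ ℓ ⊔ ℓₑ)
    StorageComonad = Σ RawComonad IsStorageComonad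

  record DistributiveLaw (K₁ K₂ : Comonad) : Set (o ⊔ ℓ ⊔ ℓₑ) where
    module K₁ = Comonad K₁
    module K₂ = Comonad K₂
    field
      dl : ∀ A → K₂.F₀ (K₁.F₀ A) ⇒ K₁.F₀ (K₂.F₀ A)
      dl-natural : ∀ {A B} {f : A ⇒ B} →
                   dl B ∘ K₂.F₁ (K₁.F₁ f) ≈ K₁.F₁ (K₂.F₁ f) ∘ dl A
      dl-δ₁ : ∀ {A} → K₁.F₁ (dl A) ∘ dl (K₁.F₀ A) ∘ K₂.F₁ (K₁.δ A) ≈ K₁.δ (K₂.F₀ A) ∘ dl A
      dl-δ₂ : ∀ {A} → dl (K₂.F₀ A) ∘ K₂.F₁ (dl A) ∘ K₂.δ (K₁.F₀ A) ≈ K₁.F₁ (K₂.δ A) ∘ dl A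
      dl-ε₂ : ∀ {A} → K₁.F₁ (K₂.ε A) ∘ dl A ≈ K₂.ε (K₁.F₀ A)
      dl-ε₁ : ∀ {A} → K₁.ε (K₂.F₀ A) ∘ dl A ≈ K₂.F₁ (K₁.ε A)

  module _ where
    private
      module Eq {A B} = IsEquivalence (equiv {A} {B})

    composeF : Endofunctor → Endofunctor → Endofunctor
    composeF G F = record
      { F₀ = λ A → G.F₀ (F.F₀ A)
      ; F₁ = λ f → G.F₁ (F.F₁ f)
      ; identity = Eq.trans (G.F-resp-≈ F.identity) G.identity
      ; homomorphism = Eq.trans (G.F-resp-≈ F.homomorphism) G.homomorphism
      ; F-resp-≈ = λ p → G.F-resp-≈ (F.F-resp-≈ p)
      }
      where module G = Endofunctor G
            module F = Endofunctor F

  compositeComonad : (K₁ K₂ : Comonad) → DistributiveLaw K₁ K₂ → RawComonad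
  compositeComonad K₁ K₂ L = record
    { functor = composeF K₂.functor K₁.functor
    ; ε = λ A → K₁.ε A ∘ K₂.ε (K₁.F₀ A)
    ; δ = λ A → K₂.F₁ (dl (K₁.F₀ A)) ∘ K₂.δ (K₁.F₀ (K₁.F₀ A)) ∘ K₂.F₁ (K₁.δ A)
    }
    where module K₁ = Comonad K₁
          module K₂ = Comonad K₂
          open DistributiveLaw L using (dl)

module Submission where

-- The proof has two independent halves.
--  * Beck's theorem (module CompositeComonad): for ANY two comonads and a
--    distributive law, the composite data satisfies the comonad laws.  The only
--    non-routine law is coassociativity, where both sides are rewritten to one
--    common seven-fold composite; the key step is how λ commutes with the
--    composite comultiplication (dl-δ¹²).
--  * Transport of the storage structure (compositeStorage): the comonoid on
--    !₁₂A = !₂(!₁A) is the one !₂ already carries.  The composite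
--    comultiplication !₂λ ∘ δ² ∘ !₂δ¹ is a composite of comonoid morphisms
--    between free comonoids (module FreeComonoidMorphisms), hence one itself; the
--    Seely maps of !₁₂ are those of !₂ precomposed with !₂ applied to the Seely
--    isomorphisms of !₁, hence isomorphisms.

open import Level using (Level)
open import Relation.Binary using (Setoid; IsEquivalence)
import Relation.Binary.Reasoning.Setoid as SetoidReasoning
open import Data.Product using (_,_)
open import Defs

module CategoryKit {o ℓ ℓₑ : Level} (C : Category o ℓ ℓₑ) where
  open Category C

  hom-setoid : ∀ {A B} → Setoid ℓ ℓₑ
  hom-setoid {A} {B} = record { Carrier = A ⇒ B ; _≈_ = _≈_ ; isEquivalence = equiv }

  module HomReasoning {A B : Obj} where
    open SetoidReasoning (hom-setoid {A} {B}) public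

  open module HomEq {A B : Obj} = IsEquivalence (equiv {A} {B}) public
    renaming (refl to ≈-refl; sym to ≈-sym; trans to ≈-trans)

  infixr 4 refl⟩∘⟨_
  infixl 5 _⟩∘⟨refl

  refl⟩∘⟨_ : ∀ {A B D} {f : B ⇒ D} {g g′ : A ⇒ B} → g ≈ g′ → f ∘ g ≈ f ∘ g′
  refl⟩∘⟨ p = ∘-resp-≈ ≈-refl p

  _⟩∘⟨refl : ∀ {A B D} {f f′ : B ⇒ D} {g : A ⇒ B} → f ≈ f′ → f ∘ g ≈ f′ ∘ g
  p ⟩∘⟨refl = ∘-resp-≈ p ≈-refl

  assoc² : ∀ {A B D E F} {a : E ⇒ F} {b : D ⇒ E} {c : B ⇒ D} {d : A ⇒ B} →
           (a ∘ b ∘ c) ∘ d ≈ a ∘ b ∘ c ∘ d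
  assoc² = ≈-trans assoc (refl⟩∘⟨ assoc)

  pullˡ : ∀ {A B D E} {a : D ⇒ E} {b : B ⇒ D} {c : B ⇒ E} {f : A ⇒ B} →
          a ∘ b ≈ c → a ∘ b ∘ f ≈ c ∘ f
  pullˡ p = ≈-trans (≈-sym assoc) (p ⟩∘⟨refl)

  cancelˡ : ∀ {A B D} {a : D ⇒ B} {b : B ⇒ D} {f : A ⇒ B} → a ∘ b ≈ id → a ∘ b ∘ f ≈ f
  cancelˡ p = ≈-trans (pullˡ p) identityˡ

  extendʳ : ∀ {A B B′ D E} {a : D ⇒ E} {b : B ⇒ D} {a′ : B′ ⇒ E} {b′ : B ⇒ B′} {f : A ⇒ B} →
            a ∘ b ≈ a′ ∘ b′ → a ∘ b ∘ f ≈ a′ ∘ b′ ∘ f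
  extendʳ p = ≈-trans (pullˡ p) assoc

  IsIso-resp-≈ : ∀ {A B} {f g : A ⇒ B} → f ≈ g → IsIso C f → IsIso C g
  IsIso-resp-≈ p (h , l , r) = h , ≈-trans (refl⟩∘⟨ ≈-sym p) l , ≈-trans (≈-sym p ⟩∘⟨refl) r

  IsIso-∘ : ∀ {A B D} {f : A ⇒ B} {g : B ⇒ D} → IsIso C f → IsIso C g → IsIso C (g ∘ f)
  IsIso-∘ (f⁻¹ , fl , fr) (g⁻¹ , gl , gr) =
    f⁻¹ ∘ g⁻¹ ,
    ≈-trans assoc (≈-trans (refl⟩∘⟨ cancelˡ gl) fl) ,
    ≈-trans assoc (≈-trans (refl⟩∘⟨ cancelˡ fr) gr)

module FunctorKit {o ℓ ℓₑ : Level} {C : Category o ℓ ℓₑ} (F : Endofunctor C) where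
  open Category C
  open CategoryKit C
  open Endofunctor F

  F-triangle : ∀ {A B D} {a : B ⇒ D} {b : A ⇒ B} {c : A ⇒ D} → a ∘ b ≈ c → F₁ a ∘ F₁ b ≈ F₁ c
  F-triangle p = ≈-trans (≈-sym homomorphism) (F-resp-≈ p)

  F-square : ∀ {A B B′ D} {a : B ⇒ D} {b : A ⇒ B} {a′ : B′ ⇒ D} {b′ : A ⇒ B′} →
             a ∘ b ≈ a′ ∘ b′ → F₁ a ∘ F₁ b ≈ F₁ a′ ∘ F₁ b′
  F-square p = ≈-trans (F-triangle p) homomorphism

  F-inverse : ∀ {A B} {a : B ⇒ A} {b : A ⇒ B} → a ∘ b ≈ id → F₁ a ∘ F₁ b ≈ id
  F-inverse p = ≈-trans (F-triangle p) identity

  F-iso : ∀ {A B} {f : A ⇒ B} → IsIso C f → IsIso C (F₁ f)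
  F-iso (g , l , r) = F₁ g , F-inverse l , F-inverse r

  homomorphism³ : ∀ {A B D E} {a : D ⇒ E} {b : B ⇒ D} {c : A ⇒ B} →
                  F₁ (a ∘ b ∘ c) ≈ F₁ a ∘ F₁ b ∘ F₁ c
  homomorphism³ = ≈-trans homomorphism (refl⟩∘⟨ homomorphism)

module CompositeComonad {o ℓ ℓₑ : Level} {C : Category o ℓ ℓₑ}
    (K₁ K₂ : Comonad C) (L : DistributiveLaw C K₁ K₂) where
  open Category C
  open CategoryKit C
  open HomReasoning
  open DistributiveLaw L using (dl; dl-natural; dl-δ₁; dl-δ₂; dl-ε₂; dl-ε₁)
  module K₁ = Comonad K₁
  module K₂ = Comonad K₂
  module F = FunctorKit K₁.functor
  module G = FunctorKit K₂.functor
  open K₁ using (F₀; F₁) renaming (ε to ε¹; δ to δ¹)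
  open K₂ using () renaming (F₀ to G₀; F₁ to G₁; ε to ε²; δ to δ²)

  H : RawComonad C
  H = compositeComonad C K₁ K₂ L

  open RawComonad H using () renaming (ε to ε¹²; δ to δ¹²)

  ε¹²-natural : ∀ {A B} {f : A ⇒ B} → ε¹² B ∘ G₁ (F₁ f) ≈ f ∘ ε¹² A
  ε¹²-natural {A} {B} {f} = begin
      (ε¹ B ∘ ε² (F₀ B)) ∘ G₁ (F₁ f) ≈⟨ assoc ⟩
      ε¹ B ∘ ε² (F₀ B) ∘ G₁ (F₁ f)   ≈⟨ refl⟩∘⟨ K₂.ε-natural ⟩
      ε¹ B ∘ F₁ f ∘ ε² (F₀ A)        ≈⟨ pullˡ K₁.ε-natural ⟩
      (f ∘ ε¹ A) ∘ ε² (F₀ A)         ≈⟨ assoc ⟩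
      f ∘ ε¹ A ∘ ε² (F₀ A)           ∎

  δ¹²-natural : ∀ {A B} {f : A ⇒ B} → δ¹² B ∘ G₁ (F₁ f) ≈ G₁ (F₁ (G₁ (F₁ f))) ∘ δ¹² A
  δ¹²-natural {A} {B} {f} = begin
      (G₁ (dl (F₀ B)) ∘ δ² (F₀ (F₀ B)) ∘ G₁ (δ¹ B)) ∘ G₁ (F₁ f)
    ≈⟨ assoc² ⟩
      G₁ (dl (F₀ B)) ∘ δ² (F₀ (F₀ B)) ∘ G₁ (δ¹ B) ∘ G₁ (F₁ f)
    ≈⟨ refl⟩∘⟨ refl⟩∘⟨ G.F-square K₁.δ-natural ⟩
      G₁ (dl (F₀ B)) ∘ δ² (F₀ (F₀ B)) ∘ G₁ (F₁ (F₁ f)) ∘ G₁ (δ¹ A)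
    ≈⟨ refl⟩∘⟨ extendʳ K₂.δ-natural ⟩
      G₁ (dl (F₀ B)) ∘ G₁ (G₁ (F₁ (F₁ f))) ∘ δ² (F₀ (F₀ A)) ∘ G₁ (δ¹ A)
    ≈⟨ extendʳ (G.F-square dl-natural) ⟩
      G₁ (F₁ (G₁ (F₁ f))) ∘ G₁ (dl (F₀ A)) ∘ δ² (F₀ (F₀ A)) ∘ G₁ (δ¹ A)
    ∎

  dl-ε¹² : ∀ {A} → F₁ (ε¹² A) ∘ dl (F₀ A) ≈ F₁ (ε¹ A) ∘ ε² (F₀ (F₀ A))
  dl-ε¹² {A} = begin
      F₁ (ε¹ A ∘ ε² (F₀ A)) ∘ dl (F₀ A)         ≈⟨ K₁.homomorphism ⟩∘⟨refl ⟩
      (F₁ (ε¹ A) ∘ F₁ (ε² (F₀ A))) ∘ dl (F₀ A)  ≈⟨ assoc ⟩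
      F₁ (ε¹ A) ∘ F₁ (ε² (F₀ A)) ∘ dl (F₀ A)    ≈⟨ refl⟩∘⟨ dl-ε₂ ⟩
      F₁ (ε¹ A) ∘ ε² (F₀ (F₀ A))                ∎

  identityˡ-ε¹² : ∀ {A} → G₁ (F₁ (ε¹² A)) ∘ δ¹² A ≈ id
  identityˡ-ε¹² {A} = begin
      G₁ (F₁ (ε¹² A)) ∘ G₁ (dl (F₀ A)) ∘ δ² (F₀ (F₀ A)) ∘ G₁ (δ¹ A)
    ≈⟨ pullˡ (G.F-triangle dl-ε¹²) ⟩
      G₁ (F₁ (ε¹ A) ∘ ε² (F₀ (F₀ A))) ∘ δ² (F₀ (F₀ A)) ∘ G₁ (δ¹ A)
    ≈⟨ K₂.homomorphism ⟩∘⟨refl ⟩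
      (G₁ (F₁ (ε¹ A)) ∘ G₁ (ε² (F₀ (F₀ A)))) ∘ δ² (F₀ (F₀ A)) ∘ G₁ (δ¹ A)
    ≈⟨ assoc ⟩
      G₁ (F₁ (ε¹ A)) ∘ G₁ (ε² (F₀ (F₀ A))) ∘ δ² (F₀ (F₀ A)) ∘ G₁ (δ¹ A)
    ≈⟨ refl⟩∘⟨ cancelˡ K₂.identityˡ-ε ⟩
      G₁ (F₁ (ε¹ A)) ∘ G₁ (δ¹ A)
    ≈⟨ G.F-inverse K₁.identityˡ-ε ⟩
      id
    ∎

  identityʳ-ε¹² : ∀ {A} → ε¹² (G₀ (F₀ A)) ∘ δ¹² A ≈ id
  identityʳ-ε¹² {A} = begin
      (ε¹ (G₀ (F₀ A)) ∘ ε² (F₀ (G₀ (F₀ A)))) ∘ G₁ (dl (F₀ A)) ∘ δ² (F₀ (F₀ A)) ∘ G₁ (δ¹ A)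
    ≈⟨ assoc ⟩
      ε¹ (G₀ (F₀ A)) ∘ ε² (F₀ (G₀ (F₀ A))) ∘ G₁ (dl (F₀ A)) ∘ δ² (F₀ (F₀ A)) ∘ G₁ (δ¹ A)
    ≈⟨ refl⟩∘⟨ extendʳ K₂.ε-natural ⟩
      ε¹ (G₀ (F₀ A)) ∘ dl (F₀ A) ∘ ε² (G₀ (F₀ (F₀ A))) ∘ δ² (F₀ (F₀ A)) ∘ G₁ (δ¹ A)
    ≈⟨ pullˡ dl-ε₁ ⟩
      G₁ (ε¹ (F₀ A)) ∘ ε² (G₀ (F₀ (F₀ A))) ∘ δ² (F₀ (F₀ A)) ∘ G₁ (δ¹ A)
    ≈⟨ refl⟩∘⟨ cancelˡ K₂.identityʳ-ε ⟩
      G₁ (ε¹ (F₀ A)) ∘ G₁ (δ¹ A)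
    ≈⟨ G.F-inverse K₁.identityʳ-ε ⟩
      id
    ∎

  -- How λ passes the composite comultiplication: this is where both Beck
  -- axioms for comultiplications enter the coassociativity proof (dl-δ₂ here,
  -- dl-δ₁ in coassoc-right).
  dl-δ¹² : ∀ {A} → F₁ (δ¹² A) ∘ dl (F₀ A) ≈
           dl (F₀ (G₀ (F₀ A))) ∘ G₁ (F₁ (dl (F₀ A))) ∘ G₁ (dl (F₀ (F₀ A)))
             ∘ δ² (F₀ (F₀ (F₀ A))) ∘ G₁ (F₁ (δ¹ A))
  dl-δ¹² {A} = begin
      F₁ (G₁ (dl (F₀ A)) ∘ δ² (F₀ (F₀ A)) ∘ G₁ (δ¹ A)) ∘ dl (F₀ A)
    ≈⟨ F.homomorphism³ ⟩∘⟨refl ⟩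
      (F₁ (G₁ (dl (F₀ A))) ∘ F₁ (δ² (F₀ (F₀ A))) ∘ F₁ (G₁ (δ¹ A))) ∘ dl (F₀ A)
    ≈⟨ assoc² ⟩
      F₁ (G₁ (dl (F₀ A))) ∘ F₁ (δ² (F₀ (F₀ A))) ∘ F₁ (G₁ (δ¹ A)) ∘ dl (F₀ A)
    ≈⟨ refl⟩∘⟨ refl⟩∘⟨ dl-natural ⟨
      F₁ (G₁ (dl (F₀ A))) ∘ F₁ (δ² (F₀ (F₀ A))) ∘ dl (F₀ (F₀ A)) ∘ G₁ (F₁ (δ¹ A))
    ≈⟨ refl⟩∘⟨ pullˡ (≈-sym dl-δ₂) ⟩
      F₁ (G₁ (dl (F₀ A))) ∘ (dl (G₀ (F₀ (F₀ A))) ∘ G₁ (dl (F₀ (F₀ A))) ∘ δ² (F₀ (F₀ (F₀ A))))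
        ∘ G₁ (F₁ (δ¹ A))
    ≈⟨ refl⟩∘⟨ assoc² ⟩
      F₁ (G₁ (dl (F₀ A))) ∘ dl (G₀ (F₀ (F₀ A))) ∘ G₁ (dl (F₀ (F₀ A))) ∘ δ² (F₀ (F₀ (F₀ A)))
        ∘ G₁ (F₁ (δ¹ A))
    ≈⟨ extendʳ (≈-sym dl-natural) ⟩
      dl (F₀ (G₀ (F₀ A))) ∘ G₁ (F₁ (dl (F₀ A))) ∘ G₁ (dl (F₀ (F₀ A))) ∘ δ² (F₀ (F₀ (F₀ A)))
        ∘ G₁ (F₁ (δ¹ A))
    ∎

  -- The common normal form of both sides of coassociativity.
  δ¹²-twice : ∀ A → G₀ (F₀ A) ⇒ G₀ (F₀ (G₀ (F₀ (G₀ (F₀ A)))))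
  δ¹²-twice A = G₁ (dl (F₀ (G₀ (F₀ A)))) ∘ G₁ (G₁ (F₁ (dl (F₀ A)))) ∘ G₁ (G₁ (dl (F₀ (F₀ A))))
                ∘ G₁ (δ² (F₀ (F₀ (F₀ A)))) ∘ δ² (F₀ (F₀ (F₀ A))) ∘ G₁ (δ¹ (F₀ A)) ∘ G₁ (δ¹ A)

  coassoc-left : ∀ {A} → G₁ (F₁ (δ¹² A)) ∘ δ¹² A ≈ δ¹²-twice A
  coassoc-left {A} = begin
      G₁ (F₁ (δ¹² A)) ∘ G₁ (dl (F₀ A)) ∘ δ² (F₀ (F₀ A)) ∘ G₁ (δ¹ A)
    ≈⟨ pullˡ (G.F-triangle dl-δ¹²) ⟩
      G₁ (dl (F₀ (G₀ (F₀ A))) ∘ G₁ (F₁ (dl (F₀ A))) ∘ (G₁ (dl (F₀ (F₀ A)))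
           ∘ δ² (F₀ (F₀ (F₀ A))) ∘ G₁ (F₁ (δ¹ A))))
        ∘ δ² (F₀ (F₀ A)) ∘ G₁ (δ¹ A)
    ≈⟨ ≈-trans G.homomorphism³ (refl⟩∘⟨ refl⟩∘⟨ G.homomorphism³) ⟩∘⟨refl ⟩
      (G₁ (dl (F₀ (G₀ (F₀ A)))) ∘ G₁ (G₁ (F₁ (dl (F₀ A)))) ∘ (G₁ (G₁ (dl (F₀ (F₀ A))))
           ∘ G₁ (δ² (F₀ (F₀ (F₀ A)))) ∘ G₁ (G₁ (F₁ (δ¹ A)))))
        ∘ δ² (F₀ (F₀ A)) ∘ G₁ (δ¹ A)
    ≈⟨ ≈-trans assoc² (refl⟩∘⟨ refl⟩∘⟨ assoc²) ⟩
      G₁ (dl (F₀ (G₀ (F₀ A)))) ∘ G₁ (G₁ (F₁ (dl (F₀ A)))) ∘ G₁ (G₁ (dl (F₀ (F₀ A))))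
        ∘ G₁ (δ² (F₀ (F₀ (F₀ A)))) ∘ G₁ (G₁ (F₁ (δ¹ A))) ∘ δ² (F₀ (F₀ A)) ∘ G₁ (δ¹ A)
    ≈⟨ refl⟩∘⟨ refl⟩∘⟨ refl⟩∘⟨ refl⟩∘⟨ extendʳ (≈-sym K₂.δ-natural) ⟩
      G₁ (dl (F₀ (G₀ (F₀ A)))) ∘ G₁ (G₁ (F₁ (dl (F₀ A)))) ∘ G₁ (G₁ (dl (F₀ (F₀ A))))
        ∘ G₁ (δ² (F₀ (F₀ (F₀ A)))) ∘ δ² (F₀ (F₀ (F₀ A))) ∘ G₁ (F₁ (δ¹ A)) ∘ G₁ (δ¹ A)
    ≈⟨ refl⟩∘⟨ refl⟩∘⟨ refl⟩∘⟨ refl⟩∘⟨ refl⟩∘⟨ G.F-square K₁.δ-assoc ⟩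
      δ¹²-twice A
    ∎

  coassoc-right : ∀ {A} → δ¹² (G₀ (F₀ A)) ∘ δ¹² A ≈ δ¹²-twice A
  coassoc-right {A} = begin
      (G₁ (dl (F₀ (G₀ (F₀ A)))) ∘ δ² _ ∘ G₁ (δ¹ (G₀ (F₀ A))))
        ∘ G₁ (dl (F₀ A)) ∘ δ² (F₀ (F₀ A)) ∘ G₁ (δ¹ A)
    ≈⟨ assoc² ⟩
      G₁ (dl (F₀ (G₀ (F₀ A)))) ∘ δ² _ ∘ G₁ (δ¹ (G₀ (F₀ A)))
        ∘ G₁ (dl (F₀ A)) ∘ δ² (F₀ (F₀ A)) ∘ G₁ (δ¹ A)
    ≈⟨ refl⟩∘⟨ refl⟩∘⟨ pullˡ (≈-trans (G.F-triangle (≈-sym dl-δ₁)) G.homomorphism³) ⟩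
      G₁ (dl (F₀ (G₀ (F₀ A)))) ∘ δ² _
        ∘ (G₁ (F₁ (dl (F₀ A))) ∘ G₁ (dl (F₀ (F₀ A))) ∘ G₁ (G₁ (δ¹ (F₀ A))))
        ∘ δ² (F₀ (F₀ A)) ∘ G₁ (δ¹ A)
    ≈⟨ refl⟩∘⟨ refl⟩∘⟨ assoc² ⟩
      G₁ (dl (F₀ (G₀ (F₀ A)))) ∘ δ² _ ∘ G₁ (F₁ (dl (F₀ A))) ∘ G₁ (dl (F₀ (F₀ A)))
        ∘ G₁ (G₁ (δ¹ (F₀ A))) ∘ δ² (F₀ (F₀ A)) ∘ G₁ (δ¹ A)
    ≈⟨ refl⟩∘⟨ extendʳ K₂.δ-natural ⟩
      G₁ (dl (F₀ (G₀ (F₀ A)))) ∘ G₁ (G₁ (F₁ (dl (F₀ A)))) ∘ δ² _ ∘ G₁ (dl (F₀ (F₀ A)))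
        ∘ G₁ (G₁ (δ¹ (F₀ A))) ∘ δ² (F₀ (F₀ A)) ∘ G₁ (δ¹ A)
    ≈⟨ refl⟩∘⟨ refl⟩∘⟨ extendʳ K₂.δ-natural ⟩
      G₁ (dl (F₀ (G₀ (F₀ A)))) ∘ G₁ (G₁ (F₁ (dl (F₀ A)))) ∘ G₁ (G₁ (dl (F₀ (F₀ A)))) ∘ δ² _
        ∘ G₁ (G₁ (δ¹ (F₀ A))) ∘ δ² (F₀ (F₀ A)) ∘ G₁ (δ¹ A)
    ≈⟨ refl⟩∘⟨ refl⟩∘⟨ refl⟩∘⟨ extendʳ K₂.δ-natural ⟩
      G₁ (dl (F₀ (G₀ (F₀ A)))) ∘ G₁ (G₁ (F₁ (dl (F₀ A)))) ∘ G₁ (G₁ (dl (F₀ (F₀ A))))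
        ∘ G₁ (G₁ (G₁ (δ¹ (F₀ A)))) ∘ δ² _ ∘ δ² (F₀ (F₀ A)) ∘ G₁ (δ¹ A)
    ≈⟨ refl⟩∘⟨ refl⟩∘⟨ refl⟩∘⟨ refl⟩∘⟨ extendʳ (≈-sym K₂.δ-assoc) ⟩
      G₁ (dl (F₀ (G₀ (F₀ A)))) ∘ G₁ (G₁ (F₁ (dl (F₀ A)))) ∘ G₁ (G₁ (dl (F₀ (F₀ A))))
        ∘ G₁ (G₁ (G₁ (δ¹ (F₀ A)))) ∘ G₁ (δ² (F₀ (F₀ A))) ∘ δ² (F₀ (F₀ A)) ∘ G₁ (δ¹ A)
    ≈⟨ refl⟩∘⟨ refl⟩∘⟨ refl⟩∘⟨ extendʳ (G.F-square (≈-sym K₂.δ-natural)) ⟩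
      G₁ (dl (F₀ (G₀ (F₀ A)))) ∘ G₁ (G₁ (F₁ (dl (F₀ A)))) ∘ G₁ (G₁ (dl (F₀ (F₀ A))))
        ∘ G₁ (δ² (F₀ (F₀ (F₀ A)))) ∘ G₁ (G₁ (δ¹ (F₀ A))) ∘ δ² (F₀ (F₀ A)) ∘ G₁ (δ¹ A)
    ≈⟨ refl⟩∘⟨ refl⟩∘⟨ refl⟩∘⟨ refl⟩∘⟨ extendʳ (≈-sym K₂.δ-natural) ⟩
      δ¹²-twice A
    ∎

  isComonad : IsComonad C H
  isComonad = record
    { ε-natural   = ε¹²-natural
    ; δ-natural   = δ¹²-natural
    ; identityˡ-ε = identityˡ-ε¹²
    ; identityʳ-ε = identityʳ-ε¹²
    ; δ-assoc     = ≈-trans coassoc-left (≈-sym coassoc-right)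
    }

module FreeComonoidMorphisms {o ℓ ℓₑ : Level} {C : Category o ℓ ℓₑ}
    {M : SymmetricMonoidal C} {P : FiniteProducts C}
    (K : Comonad C) (S : StorageStructure C M P (Comonad.raw K)) where
  open Category C
  open CategoryKit C
  open HomReasoning
  open SymmetricMonoidal M
  open FiniteProducts P
  open Comonad K using (F₀; F₁; δ; functor)
  open StorageStructure S using (c; e; c-natural; e-natural; δ-c; δ-e)
  open FunctorKit functor using (F-triangle)

  record IsComonoidMorphism {X Y : Obj} (h : F₀ X ⇒ F₀ Y) : Set ℓₑ where
    field
      preserves-c : c Y ∘ h ≈ (h ⊗₁ h) ∘ c X
      preserves-e : e Y ∘ h ≈ e X

  open IsComonoidMorphism

  F₁-comonoidMorphism : ∀ {X Y} (f : X ⇒ Y) → IsComonoidMorphism (F₁ f)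
  F₁-comonoidMorphism f = record { preserves-c = c-natural ; preserves-e = e-natural }

  δ-comonoidMorphism : ∀ X → IsComonoidMorphism (δ X)
  δ-comonoidMorphism X = record { preserves-c = δ-c X ; preserves-e = δ-e X }

  ∘-comonoidMorphism : ∀ {X Y Z} {g : F₀ Y ⇒ F₀ Z} {h : F₀ X ⇒ F₀ Y} →
                       IsComonoidMorphism g → IsComonoidMorphism h → IsComonoidMorphism (g ∘ h)
  ∘-comonoidMorphism {X} {Y} {Z} {g} {h} gᶜ hᶜ = record
    { preserves-c = begin
        c Z ∘ g ∘ h                   ≈⟨ extendʳ (preserves-c gᶜ) ⟩
        (g ⊗₁ g) ∘ c Y ∘ h            ≈⟨ refl⟩∘⟨ preserves-c hᶜ ⟩
        (g ⊗₁ g) ∘ (h ⊗₁ h) ∘ c X     ≈⟨ pullˡ (≈-sym ⊗-homomorphism) ⟩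
        ((g ∘ h) ⊗₁ (g ∘ h)) ∘ c X    ∎
    ; preserves-e = ≈-trans (pullˡ (preserves-e gᶜ)) (preserves-e hᶜ)
    }

  seely-pairing : ∀ {X Y Z} (f : Z ⇒ X) (g : Z ⇒ Y) →
                  ((F₁ π₁ ⊗₁ F₁ π₂) ∘ c (X ×₀ Y)) ∘ F₁ ⟨ f , g ⟩ ≈ (F₁ f ⊗₁ F₁ g) ∘ c Z
  seely-pairing {X} {Y} {Z} f g = begin
      ((F₁ π₁ ⊗₁ F₁ π₂) ∘ c (X ×₀ Y)) ∘ F₁ ⟨ f , g ⟩
    ≈⟨ assoc ⟩
      (F₁ π₁ ⊗₁ F₁ π₂) ∘ c (X ×₀ Y) ∘ F₁ ⟨ f , g ⟩
    ≈⟨ refl⟩∘⟨ c-natural ⟩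
      (F₁ π₁ ⊗₁ F₁ π₂) ∘ (F₁ ⟨ f , g ⟩ ⊗₁ F₁ ⟨ f , g ⟩) ∘ c Z
    ≈⟨ pullˡ (≈-sym ⊗-homomorphism) ⟩
      ((F₁ π₁ ∘ F₁ ⟨ f , g ⟩) ⊗₁ (F₁ π₂ ∘ F₁ ⟨ f , g ⟩)) ∘ c Z
    ≈⟨ ⊗-resp-≈ (F-triangle project₁) (F-triangle project₂) ⟩∘⟨refl ⟩
      (F₁ f ⊗₁ F₁ g) ∘ c Z
    ∎

-- The storage structure of !₂ restricted to the objects !₁A is a storage
-- structure on the composite: comonoids and their naturality are inherited,
-- axiom (2) holds because the composite comultiplication is a composite of
-- comonoid morphisms, and the Seely maps of !₁₂ are those of !₂ precomposed
-- with !₂ applied to the Seely isomorphisms of !₁.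
compositeStorage : ∀ {o ℓ ℓₑ : Level} {C : Category o ℓ ℓₑ}
                   {M : SymmetricMonoidal C} {P : FiniteProducts C}
                   (K₁ K₂ : Comonad C) (L : DistributiveLaw C K₁ K₂) →
                   PreservesFiniteProducts C P K₁ → StorageStructure C M P (Comonad.raw K₂) →
                   StorageStructure C M P (compositeComonad C K₁ K₂ L)
compositeStorage {C = C} {P = P} K₁ K₂ L (preserves-⊤ , preserves-×) S = record
  { c          = λ A → c (F₀ A)
  ; e          = λ A → e (F₀ A)
  ; comonoid   = λ A → comonoid (F₀ A)
  ; c-natural  = c-natural
  ; e-natural  = e-natural
  ; δ-c        = λ A → IsComonoidMorphism.preserves-c (δ¹²-comonoidMorphism A)
  ; δ-e        = λ A → IsComonoidMorphism.preserves-e (δ¹²-comonoidMorphism A)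
  ; seely-unit = IsIso-resp-≈ e-natural (IsIso-∘ (G.F-iso preserves-⊤) seely-unit)
  ; seely-pair = λ A B → IsIso-resp-≈ (seely-pairing (F₁ π₁) (F₁ π₂))
                           (IsIso-∘ (G.F-iso (preserves-× A B)) (seely-pair (F₀ A) (F₀ B)))
  }
  where
    open CategoryKit C using (IsIso-resp-≈; IsIso-∘)
    open FiniteProducts P using (π₁; π₂)
    open Comonad K₁ using (F₀; F₁) renaming (δ to δ¹)
    open DistributiveLaw L using (dl)
    open StorageStructure S
    open FreeComonoidMorphisms K₂ S
    module G = FunctorKit (Comonad.functor K₂)

    δ¹²-comonoidMorphism : ∀ A → IsComonoidMorphism (RawComonad.δ (compositeComonad C K₁ K₂ L) A)
    δ¹²-comonoidMorphism A =
      ∘-comonoidMorphism (F₁-comonoidMorphism (dl (F₀ A)))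
        (∘-comonoidMorphism (δ-comonoidMorphism (F₀ (F₀ A))) (F₁-comonoidMorphism (δ¹ A)))

lemma2p4 : ∀ {o ℓ e : Level} (C : Category o ℓ e) (M : SymmetricMonoidal C) (P : FiniteProducts C)
           (K₁ : Comonad C) → PreservesFiniteProducts C P K₁ →
           (K₂ : Comonad C) → StorageStructure C M P (Comonad.raw K₂) →
           (L : DistributiveLaw C K₁ K₂) →
           IsStorageComonad C M P (compositeComonad C K₁ K₂ L)
lemma2p4 C M P K₁ preserves K₂ storage L =
  CompositeComonad.isComonad K₁ K₂ L , compositeStorage K₁ K₂ L preserves storage
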